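{- Let $\rho$ be a kernel permutation. The relation $\prec$ is a linear order on the set of feasible cells of $\rho$. In particular, there are no two feasible cells $C_{ml}$ and $C_{m'l'}$ with $l<l'$ and $m<m'$.
   Context: Patterns. An occurrence of $132$ in $\pi\in S_n$ is a triple of positions $i<j<k$ with $\pi(i)<\pi(k)<\pi(j)$. The graph $G_\pi$. $G_\pi$ is the bipartite graph whose vertices are the entries of $\pi$ and the occurrences of $132$ in $\pi$. An entry is adjacent to an occurrence exactly when it is one of the three entries of that occurrence. Kernel permutations. The kernel of $\pi\in S_n$ is the subsequence of entries in the component of $G_\pi$ containing $n$. Its kernel shape is the permutation order-isomorphic to it. $\rho\in S_s$ is a kernel permutation if it is the kernel shape of some permutation. Cells. For $1\leq m\leq s$ and $1\leq l\leq s+1$, $C_{ml}$ denotes the cell consisting of positions strictly between the $(l-1)$-st and $l$-th kernel positions and values strictly between the $(m-1)$-st and $m$-th smallest kernel values. Kernel position $0$ and value $0$ are placed before and below everything, and kernel position $s+1$ after everything. Feasibility. $C_{ml}$ is infeasible if, in $(\rho(1),\dots,\rho(l-1),m-\tfrac12,\rho(l),\dots,\rho(s))$, the inserted entry $m-\tfrac12$ belongs to some occurrence of $132$. Otherwise it is feasible. The relation $\prec$. For distinct feasible cells, $C_{ml}\prec C_{m'l'}$ if $m\geq m'$ and $l\leq l'$. -}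

module Defs where

open import Data.Nat as ℕ using (ℕ; zero; suc; _*_; _+_)
open import Data.Fin as Fin using (Fin; toℕ)
open import Data.Product using (Σ; ∃; ∃-syntax; _×_; _,_; proj₁)
open import Data.Sum using (_⊎_)
open import Data.Vec.Functional using (insertAt)
open import Function.Base using (_∘_; _on_)
open import Function.Definitions using (Injective)
open import Function.Bundles using (_⇔_)
open import Relation.Binary.PropositionalEquality using (_≡_; _≢_)
open import Relation.Binary.Construct.Closure.ReflexiveTransitive using (Star)
open import Relation.Nullary using (¬_)

Seq : ℕ → Set
Seq k = Fin k → ℕ

-- A permutation in S_n: an injective map Fin n → Fin n (values 0..n-1,
-- i.e. value v stands for the entry v+1).
IsPerm : {n : ℕ} → (Fin n → Fin n) → Set
IsPerm π = Injective _≡_ _≡_ π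

record Occ132 {k : ℕ} (w : Seq k) : Set where
  constructor occ
  field
    i j l  : Fin k
    i<j    : i Fin.< j
    j<l    : j Fin.< l
    wi<wl  : w i ℕ.< w l
    wl<wj  : w l ℕ.< w j

_∈Occ_ : {k : ℕ} {w : Seq k} → Fin k → Occ132 w → Set
p ∈Occ o = p ≡ Occ132.i o ⊎ (p ≡ Occ132.j o ⊎ p ≡ Occ132.l o)

CoOcc : {k : ℕ} (w : Seq k) → Fin k → Fin k → Set
CoOcc w p q = Σ (Occ132 w) λ o → p ∈Occ o × q ∈Occ o

-- Entries p and q lie in the same connected component of G_w
-- (paths between entry vertices in the bipartite graph G_w alternate
-- entry, occurrence, entry, ...).
Connected : {k : ℕ} (w : Seq k) → Fin k → Fin k → Set
Connected w = Star (CoOcc w)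

-- Position p (of π ∈ S_{n+1}) lies in the kernel, i.e. in the component
-- of G_π containing the maximal entry n+1 (value Fin.fromℕ n).
InKernel : {n : ℕ} (π : Fin (suc n) → Fin (suc n)) → Fin (suc n) → Set
InKernel {n} π p = ∃[ q ] (π q ≡ Fin.fromℕ n × Connected (toℕ ∘ π) p q)

KernelShape : {n s : ℕ} → (Fin (suc n) → Fin (suc n)) → (Fin s → Fin s) → Set
KernelShape {n} {s} π ρ =
  Σ (Fin s → Fin (suc n)) λ e →
    (∀ a b → a Fin.< b → e a Fin.< e b)
    × (∀ p → InKernel π p ⇔ (∃[ a ] e a ≡ p))
    × (∀ a b → (ρ a Fin.< ρ b) ⇔ (π (e a) Fin.< π (e b)))

-- ρ is a kernel permutation: a permutation that is the kernel shape of
-- some permutation π ∈ S_{n+1} (n+1 ≥ 1 so that the entry n+1 exists).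
KernelPerm : {s : ℕ} → (Fin s → Fin s) → Set
KernelPerm {s} ρ =
  IsPerm ρ × ∃[ n ] Σ (Fin (suc n) → Fin (suc n)) λ π → IsPerm π × KernelShape π ρ

-- Cells of ρ ∈ S_s: a pair (m-1, l-1) with 1 ≤ m ≤ s, 1 ≤ l ≤ s+1.
Cell : ℕ → Set
Cell s = Fin s × Fin (suc s)

cellM : {s : ℕ} → Cell s → ℕ
cellM (m , _) = suc (toℕ m)

cellL : {s : ℕ} → Cell s → ℕ
cellL (_ , l) = suc (toℕ l)

-- The sequence (ρ(1),…,ρ(l-1), m-1/2, ρ(l),…,ρ(s)), with all values
-- doubled to stay in ℕ: kernel value v (1-based) becomes 2v, and
-- m - 1/2 becomes 2m - 1.  The inserted entry sits at position l-1.
inserted : {s : ℕ} → (Fin s → Fin s) → Cell s → Seq (suc s)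
inserted ρ (m , l) = insertAt (λ i → 2 * suc (toℕ (ρ i))) l (suc (2 * toℕ m))

Infeasible : {s : ℕ} → (Fin s → Fin s) → Cell s → Set
Infeasible ρ (m , l) = Σ (Occ132 (inserted ρ (m , l))) λ o → l ∈Occ o

Feasible : {s : ℕ} → (Fin s → Fin s) → Cell s → Set
Feasible ρ c = ¬ Infeasible ρ c

FeasibleCell : {s : ℕ} → (Fin s → Fin s) → Set
FeasibleCell ρ = Σ (Cell _) (Feasible ρ)

_≺_ : {s : ℕ} → Cell s → Cell s → Set
c ≺ c' = c ≢ c' × (cellM c' ℕ.≤ cellM c × cellL c ℕ.≤ cellL c')

_≺F_ : {s : ℕ} {ρ : Fin s → Fin s} → FeasibleCell ρ → FeasibleCell ρ → Set
_≺F_ = _≺_ on proj₁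

_≈F_ : {s : ℕ} {ρ : Fin s → Fin s} → FeasibleCell ρ → FeasibleCell ρ → Set
_≈F_ = _≡_ on proj₁

-- Suppose feasible cells C_{ml} and C_{m'l'} had l < l' and m < m'.  Feasibility
-- of C_{m'l'} makes the set of kernel entries south-west of it (before the
-- l'-th kernel position, below the m'-th kernel value) a union of components
-- of G_ρ: an occurrence of 132 meeting this set without lying inside it would
-- give an occurrence through the entry inserted into C_{m'l'}.  But G_ρ is
-- connected, since occurrences of 132 among kernel entries of π are
-- occurrences in ρ.  Feasibility of C_{ml} puts some entry in the south-west
-- set, while the entry of value m' is outside it.  Once no such pair exists,
-- any two distinct feasible cells are comparable for ≺.
module Submission where

open import Defs
open import Data.Nat using (_<_)
open import Data.Fin using (Fin)
open import Data.Product using (_×_; proj₁)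
open import Relation.Nullary using (¬_)
open import Relation.Binary.Structures using (IsStrictTotalOrder)

open import Data.Empty using (⊥-elim)
open import Data.Fin as F using (toℕ; punchIn; punchOut; zero; suc)
open import Data.Fin.Properties as FP using (pigeonhole; punchOut-injective; any?)
open import Data.Nat as ℕ using (ℕ; suc; _*_; _≤_; z≤n; s≤s; _<?_)
open import Data.Nat.Properties as NP
  using (≤-refl; ≤-reflexive; ≤-trans; <-trans; <-≤-trans; <⇒≤; ≮⇒≥
        ; *-suc; *-monoʳ-≤; *-monoʳ-<)
open import Data.Product using (Σ; ∃; ∃-syntax; _,_; proj₂)
open import Data.Product.Properties using (≡-dec)
open import Data.Sum using (_⊎_; inj₁; inj₂)
open import Data.Vec.Functional.Properties using (insertAt-punchIn; insertAt-lookup)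
open import Function.Base using (_∘_)
open import Function.Bundles using (_⇔_; Equivalence)
open import Function.Definitions using (Injective; StrictlySurjective)
open import Level using (Level)
open import Relation.Binary.Core using (Rel)
open import Relation.Binary.Definitions using (Decidable; Trichotomous; tri<; tri≈; tri>)
open import Relation.Binary.Construct.Closure.ReflexiveTransitive using (ε; _◅_; _◅◅_; fold; reverse)
import Relation.Binary.Construct.On as On
open import Relation.Binary.PropositionalEquality
open import Relation.Binary.Structures using (IsStrictPartialOrder)
open import Relation.Nullary using (yes; no)

injective⇒strictlySurjective : ∀ {n} {f : Fin n → Fin n} →
                               Injective _≡_ _≡_ f → StrictlySurjective _≡_ f
injective⇒strictlySurjective {suc n} {f} f-inj v with any? (λ a → f a FP.≟ v)
... | yes hit = hit
... | no miss =
  let a , b , a<b , eq = pigeonhole (NP.n<1+n n) (λ a → punchOut (v≢f a))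
  in ⊥-elim (FP.<-irrefl (f-inj (punchOut-injective (v≢f a) (v≢f b) eq)) a<b)
  where
  v≢f : ∀ a → v ≢ f a
  v≢f a eq = miss (a , sym eq)

punchIn-mono-< : ∀ {n} (l : Fin (suc n)) {a b : Fin n} → a F.< b → punchIn l a F.< punchIn l b
punchIn-mono-< zero                    a<b       = s≤s a<b
punchIn-mono-< (suc l) {zero}  {suc b} _         = s≤s z≤n
punchIn-mono-< (suc l) {suc a} {suc b} (s≤s a<b) = s≤s (punchIn-mono-< l a<b)

punchIn-<-pivot : ∀ {n} (l : Fin (suc n)) {a : Fin n} → toℕ a < toℕ l → punchIn l a F.< l
punchIn-<-pivot (suc l) {zero}  _         = s≤s z≤n
punchIn-<-pivot (suc l) {suc a} (s≤s a<l) = s≤s (punchIn-<-pivot l a<l)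

pivot-<-punchIn : ∀ {n} (l : Fin (suc n)) {a : Fin n} → toℕ l ≤ toℕ a → l F.< punchIn l a
pivot-<-punchIn zero            z≤n       = s≤s z≤n
pivot-<-punchIn (suc l) {suc a} (s≤s l≤a) = s≤s (pivot-<-punchIn l l≤a)

module _ {s : ℕ} (ρ : Fin s → Fin s) (m : Fin s) (l : Fin (suc s)) where
  private
    w : Fin (suc s) → ℕ
    w = inserted ρ (m , l)

    w-pivot : w l ≡ suc (2 * toℕ m)
    w-pivot = insertAt-lookup _ l _

    w-punchIn : ∀ a → w (punchIn l a) ≡ 2 * suc (toℕ (ρ a))
    w-punchIn = insertAt-punchIn _ l _

    pivot<entry : ∀ {a} → toℕ m ≤ toℕ (ρ a) → w l < w (punchIn l a)
    pivot<entry {a} m≤ρa rewrite w-pivot | w-punchIn a | *-suc 2 (toℕ (ρ a)) =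
      s≤s (s≤s (*-monoʳ-≤ 2 m≤ρa))

    entry<pivot : ∀ {a} → toℕ (ρ a) < toℕ m → w (punchIn l a) < w l
    entry<pivot {a} ρa<m rewrite w-pivot | w-punchIn a = s≤s (*-monoʳ-≤ 2 ρa<m)

    entry<entry : ∀ {a b} → ρ a F.< ρ b → w (punchIn l a) < w (punchIn l b)
    entry<entry {a} {b} ρa<ρb rewrite w-punchIn a | w-punchIn b = *-monoʳ-< 2 (s≤s ρa<ρb)

  -- The pivot is the inserted entry m − ½ at position l; each lemma exhibits an
  -- occurrence of 132 in which it plays the named role.
  infeasible-pivot-as-1 : ∀ {a b} → toℕ l ≤ toℕ a → a F.< b →
                          toℕ m ≤ toℕ (ρ b) → ρ b F.< ρ a → Infeasible ρ (m , l)
  infeasible-pivot-as-1 l≤a a<b m≤ρb ρb<ρa =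
    occ l _ _ (pivot-<-punchIn l l≤a) (punchIn-mono-< l a<b) (pivot<entry m≤ρb) (entry<entry ρb<ρa)
    , inj₁ refl

  infeasible-pivot-as-3 : ∀ {a b} → toℕ a < toℕ l → toℕ l ≤ toℕ b →
                          ρ a F.< ρ b → toℕ (ρ b) < toℕ m → Infeasible ρ (m , l)
  infeasible-pivot-as-3 a<l l≤b ρa<ρb ρb<m =
    occ _ l _ (punchIn-<-pivot l a<l) (pivot-<-punchIn l l≤b) (entry<entry ρa<ρb) (entry<pivot ρb<m)
    , inj₂ (inj₁ refl)

  infeasible-pivot-as-2 : ∀ {a b} → a F.< b → toℕ b < toℕ l →
                          toℕ (ρ a) < toℕ m → toℕ m ≤ toℕ (ρ b) → Infeasible ρ (m , l)
  infeasible-pivot-as-2 a<b b<l ρa<m m≤ρb =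
    occ _ _ l (punchIn-mono-< l a<b) (punchIn-<-pivot l b<l) (entry<pivot ρa<m) (pivot<entry m≤ρb)
    , inj₂ (inj₂ refl)

SouthWestOf : ∀ {s} → (Fin s → Fin s) → Cell s → Fin s → Set
SouthWestOf ρ (m , l) a = toℕ a < toℕ l × toℕ (ρ a) < toℕ m

coOcc-sym : ∀ {k} {w : Seq k} {p q} → CoOcc w p q → CoOcc w q p
coOcc-sym (o , p∈o , q∈o) = o , q∈o , p∈o

module _ {s : ℕ} {ρ : Fin s → Fin s} {m : Fin s} {l : Fin (suc s)} (feasible : Feasible ρ (m , l)) where
  private
    SW : Fin s → Set
    SW = SouthWestOf ρ (m , l)

  module _ (o : Occ132 (toℕ ∘ ρ)) where
    open Occ132 o renaming (l to k; j<l to j<k; wi<wl to ρi<ρk; wl<wj to ρk<ρj)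

    private
      first⇒second : SW i → SW j
      first⇒second (i<l , ρi<m) with toℕ j <? toℕ l | toℕ (ρ j) <? toℕ m | toℕ (ρ k) <? toℕ m
      ... | yes j<l | yes ρj<m | _ = j<l , ρj<m
      ... | yes j<l | no ρj≮m  | _ =
        ⊥-elim (feasible (infeasible-pivot-as-2 ρ m l i<j j<l ρi<m (≮⇒≥ ρj≮m)))
      ... | no j≮l  | _ | yes ρk<m =
        ⊥-elim (feasible
          (infeasible-pivot-as-3 ρ m l i<l (≤-trans (≮⇒≥ j≮l) (<⇒≤ j<k)) ρi<ρk ρk<m))
      ... | no j≮l  | _ | no ρk≮m =
        ⊥-elim (feasible (infeasible-pivot-as-1 ρ m l (≮⇒≥ j≮l) j<k (≮⇒≥ ρk≮m) ρk<ρj))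

      second⇒third : SW j → SW k
      second⇒third (j<l , ρj<m) with toℕ k <? toℕ l
      ... | yes k<l = k<l , <-trans ρk<ρj ρj<m
      ... | no k≮l =
        ⊥-elim (feasible
          (infeasible-pivot-as-3 ρ m l (<-trans i<j j<l) (≮⇒≥ k≮l) ρi<ρk (<-trans ρk<ρj ρj<m)))

      third⇒first : SW k → SW i
      third⇒first (k<l , ρk<m) = <-trans i<j (<-trans j<k k<l) , <-trans ρi<ρk ρk<m

      to-first : ∀ {p} → p ∈Occ o → SW p → SW i
      to-first (inj₁ refl)        = λ sw → sw
      to-first (inj₂ (inj₁ refl)) = third⇒first ∘ second⇒third
      to-first (inj₂ (inj₂ refl)) = third⇒first

      from-first : ∀ {q} → q ∈Occ o → SW i → SW q
      from-first (inj₁ refl)        = λ sw → sw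
      from-first (inj₂ (inj₁ refl)) = first⇒second
      from-first (inj₂ (inj₂ refl)) = second⇒third ∘ first⇒second

    southWest-occurrence-closed : ∀ {p q} → p ∈Occ o → q ∈Occ o → SW p → SW q
    southWest-occurrence-closed p∈o q∈o = from-first q∈o ∘ to-first p∈o

  southWest-connected-closed : ∀ {a b} → Connected (toℕ ∘ ρ) a b → SW a → SW b
  southWest-connected-closed = fold (λ a b → SW a → SW b)
    (λ (o , a∈o , b∈o) sw-b⇒sw-c → sw-b⇒sw-c ∘ southWest-occurrence-closed o a∈o b∈o)
    (λ sw → sw)

InKernel-coOcc : ∀ {n} {π : Fin (suc n) → Fin (suc n)} {p q} →
                 CoOcc (toℕ ∘ π) p q → InKernel π q → InKernel π p
InKernel-coOcc p~q (top , π-top , q~top) = top , π-top , p~q ◅ q~top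

module _ {n s : ℕ} {π : Fin (suc n) → Fin (suc n)} {ρ : Fin s → Fin s}
         (π-injective : IsPerm π) (shape : KernelShape π ρ) where
  private
    e : Fin s → Fin (suc n)
    e = proj₁ shape

    e-mono : ∀ a b → a F.< b → e a F.< e b
    e-mono = proj₁ (proj₂ shape)

    InKernel⇔image : ∀ p → InKernel π p ⇔ (∃[ a ] e a ≡ p)
    InKernel⇔image p = proj₁ (proj₂ (proj₂ shape)) p

    order-iso : ∀ a b → (ρ a F.< ρ b) ⇔ (π (e a) F.< π (e b))
    order-iso a b = proj₂ (proj₂ (proj₂ shape)) a b

    kernel-preimage : ∀ {p} → InKernel π p → ∃[ a ] e a ≡ p
    kernel-preimage {p} = Equivalence.to (InKernel⇔image p)

    image-InKernel : ∀ a → InKernel π (e a)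
    image-InKernel a = Equivalence.from (InKernel⇔image (e a)) (a , refl)

    e-cancel-< : ∀ {a b} → e a F.< e b → a F.< b
    e-cancel-< {a} {b} ea<eb with FP.<-cmp a b
    ... | tri< a<b _ _  = a<b
    ... | tri≈ _ refl _ = ⊥-elim (FP.<-irrefl refl ea<eb)
    ... | tri> _ _ b<a  = ⊥-elim (FP.<-asym ea<eb (e-mono b a b<a))

    e-injective : ∀ {a b} → e a ≡ e b → a ≡ b
    e-injective {a} {b} ea≡eb with FP.<-cmp a b
    ... | tri< a<b _ _ = ⊥-elim (FP.<-irrefl ea≡eb (e-mono a b a<b))
    ... | tri≈ _ a≡b _ = a≡b
    ... | tri> _ _ b<a = ⊥-elim (FP.<-irrefl (sym ea≡eb) (e-mono b a b<a))

    kernel-occurrence : (o : Occ132 (toℕ ∘ π)) → (∀ {p} → p ∈Occ o → InKernel π p) →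
                        Σ (Occ132 (toℕ ∘ ρ)) λ o′ → ∀ {a} → e a ∈Occ o → a ∈Occ o′
    kernel-occurrence (occ i j k i<j j<k πi<πk πk<πj) inKernel
      with kernel-preimage (inKernel (inj₁ refl))
         | kernel-preimage (inKernel (inj₂ (inj₁ refl)))
         | kernel-preimage (inKernel (inj₂ (inj₂ refl)))
    ... | a , refl | b , refl | c , refl =
      occ a b c (e-cancel-< i<j) (e-cancel-< j<k)
          (Equivalence.from (order-iso a c) πi<πk) (Equivalence.from (order-iso c b) πk<πj)
      , λ { (inj₁ eq) → inj₁ (e-injective eq)
          ; (inj₂ (inj₁ eq)) → inj₂ (inj₁ (e-injective eq))
          ; (inj₂ (inj₂ eq)) → inj₂ (inj₂ (e-injective eq)) }

    kernel-coOcc : ∀ {a b} → CoOcc (toℕ ∘ π) (e a) (e b) → CoOcc (toℕ ∘ ρ) a b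
    kernel-coOcc {a} {b} (o , a∈o , b∈o) =
      let o′ , pullback = kernel-occurrence o
                            (λ p∈o → InKernel-coOcc (o , p∈o , b∈o) (image-InKernel b))
      in o′ , pullback a∈o , pullback b∈o

    kernel-path : ∀ {a top} → π top ≡ F.fromℕ n → Connected (toℕ ∘ π) (e a) top →
                  ∃[ c ] e c ≡ top × Connected (toℕ ∘ ρ) a c
    kernel-path {a} π-top ε = a , refl , ε
    kernel-path π-top (ea~p ◅ p~top) with kernel-preimage (_ , π-top , p~top)
    ... | b , refl =
      let c , ec≡top , b~c = kernel-path π-top p~top
      in c , ec≡top , kernel-coOcc ea~p ◅ b~c

  kernelShape-connected : ∀ a b → Connected (toℕ ∘ ρ) a b
  kernelShape-connected a b
    with image-InKernel a | image-InKernel b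
  ... | top , π-top , ea~top | top′ , π-top′ , eb~top′
    with kernel-path π-top ea~top | kernel-path π-top′ eb~top′
  ... | c , refl , a~c | c′ , refl , b~c′
    rewrite e-injective (π-injective (trans π-top (sym π-top′))) =
    a~c ◅◅ reverse coOcc-sym b~c′

southWest-nonempty : ∀ {s} {ρ : Fin s → Fin s} {m m′ : Fin s} {l l′ : Fin (suc s)} →
                     StrictlySurjective _≡_ ρ → Feasible ρ (m , l) →
                     toℕ l < toℕ l′ → toℕ m < toℕ m′ → ∃ (SouthWestOf ρ (m′ , l′))
southWest-nonempty {s} {ρ} {m} {m′} {l} {l′} ρ-surjective feasible l<l′ m<m′
  with ρ-surjective m
... | f , refl = southWest-from (F.fromℕ< l<s) (FP.toℕ-fromℕ< l<s)
  where
  l<s : toℕ l < s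
  l<s = <-≤-trans l<l′ (NP.≤-pred (FP.toℕ<n l′))

  southWest-from : ∀ a → toℕ a ≡ toℕ l → ∃ (SouthWestOf ρ (m′ , l′))
  southWest-from a a≡l with toℕ f <? toℕ l′ | toℕ (ρ a) <? toℕ m′
  ... | yes f<l′ | _         = f , f<l′ , m<m′
  ... | no f≮l′  | yes ρa<m′ = a , subst (_< toℕ l′) (sym a≡l) l<l′ , ρa<m′
  ... | no f≮l′  | no ρa≮m′  =
    -- the pivot of C_{ml}, the entry a just right of it and f (of value m) form a 132
    ⊥-elim (feasible (infeasible-pivot-as-1 ρ (ρ f) l (≤-reflexive (sym a≡l))
      (subst (_< toℕ f) (sym a≡l) (<-≤-trans l<l′ (≮⇒≥ f≮l′)))
      ≤-refl (<-≤-trans m<m′ (≮⇒≥ ρa≮m′))))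

no-northeast-pair : ∀ {s} {ρ : Fin s → Fin s} → KernelPerm ρ → (c c′ : FeasibleCell ρ) →
                    ¬ (cellL (proj₁ c) < cellL (proj₁ c′) × cellM (proj₁ c) < cellM (proj₁ c′))
no-northeast-pair {ρ = ρ} (ρ-injective , _ , _ , π-injective , shape)
                  (_ , feasible) ((m′ , _) , feasible′) (s≤s l<l′ , s≤s m<m′)
  with southWest-nonempty ρ-surjective feasible l<l′ m<m′ | ρ-surjective m′
  where
  ρ-surjective : StrictlySurjective _≡_ ρ
  ρ-surjective = injective⇒strictlySurjective ρ-injective
... | a , southWest-a | b , refl =
  -- b is the entry of value m′, which is not below the m′-th kernel value.
  NP.<-irrefl refl (proj₂ (southWest-connected-closed feasible′ a~b southWest-a))
  where
  a~b : Connected (toℕ ∘ ρ) a b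
  a~b = kernelShape-connected π-injective shape a b

cell-≡ : ∀ {s} {c c′ : Cell s} → cellM c ≡ cellM c′ → cellL c ≡ cellL c′ → c ≡ c′
cell-≡ m≡m′ l≡l′ =
  cong₂ _,_ (FP.toℕ-injective (NP.suc-injective m≡m′)) (FP.toℕ-injective (NP.suc-injective l≡l′))

≺-isStrictPartialOrder : ∀ {s} → IsStrictPartialOrder _≡_ (_≺_ {s})
≺-isStrictPartialOrder = record
  { isEquivalence = isEquivalence
  ; irrefl        = λ c≡c′ (c≢c′ , _) → c≢c′ c≡c′
  ; trans         = ≺-trans
  ; <-resp-≈      = (λ { refl c≺c′ → c≺c′ }) , (λ { refl c≺c′ → c≺c′ })
  }
  where
  ≺-trans : ∀ {s} {c c′ c″ : Cell s} → c ≺ c′ → c′ ≺ c″ → c ≺ c″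
  ≺-trans (c≢c′ , m′≤m , l≤l′) (_ , m″≤m′ , l′≤l″) =
    (λ { refl → c≢c′ (cell-≡ (NP.≤-antisym m″≤m′ m′≤m) (NP.≤-antisym l≤l′ l′≤l″)) })
    , ≤-trans m″≤m′ m′≤m , ≤-trans l≤l′ l′≤l″

≺-connected : ∀ {s} {c c′ : Cell s} →
              ¬ (cellL c < cellL c′ × cellM c < cellM c′) →
              ¬ (cellL c′ < cellL c × cellM c′ < cellM c) →
              c ≢ c′ → c ≺ c′ ⊎ c′ ≺ c
≺-connected {c = c} {c′} no-ne no-sw c≢c′ with NP.<-cmp (cellL c) (cellL c′)
... | tri< l<l′ _ _ = inj₁ (c≢c′ , ≮⇒≥ (λ m<m′ → no-ne (l<l′ , m<m′)) , <⇒≤ l<l′)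
... | tri> _ _ l′<l = inj₂ (≢-sym c≢c′ , ≮⇒≥ (λ m′<m → no-sw (l′<l , m′<m)) , <⇒≤ l′<l)
... | tri≈ _ l≡l′ _ with NP.≤-total (cellM c) (cellM c′)
...   | inj₁ m≤m′ = inj₂ (≢-sym c≢c′ , m≤m′ , ≤-reflexive (sym l≡l′))
...   | inj₂ m′≤m = inj₁ (c≢c′ , m′≤m , ≤-reflexive l≡l′)

module _ {a ℓ₁ ℓ₂ : Level} {A : Set a} {_≈_ : Rel A ℓ₁} {_<_ : Rel A ℓ₂}
         (spo : IsStrictPartialOrder _≈_ _<_) where
  open IsStrictPartialOrder spo

  dec∧connected⇒trichotomous : Decidable _≈_ → (∀ {x y} → ¬ x ≈ y → x < y ⊎ y < x) →
                               Trichotomous _≈_ _<_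
  dec∧connected⇒trichotomous _≟_ connected x y with x ≟ y
  ... | yes x≈y = tri≈ (irrefl x≈y) x≈y (irrefl (Eq.sym x≈y))
  ... | no x≉y with connected x≉y
  ...   | inj₁ x<y = tri< x<y x≉y (asym x<y)
  ...   | inj₂ y<x = tri> (asym y<x) x≉y y<x

lemma3 : {s : _} (ρ : Fin s → Fin s) → KernelPerm ρ →
    IsStrictTotalOrder (_≈F_ {s} {ρ}) (_≺F_ {s} {ρ})
    × ((c c' : FeasibleCell ρ) →
        ¬ (cellL (proj₁ c) < cellL (proj₁ c') × cellM (proj₁ c) < cellM (proj₁ c')))
lemma3 ρ kernelPerm = isStrictTotalOrder , no-northeast-pair kernelPerm
  where
  ≺F-isStrictPartialOrder : IsStrictPartialOrder _≈F_ _≺F_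
  ≺F-isStrictPartialOrder = On.isStrictPartialOrder proj₁ ≺-isStrictPartialOrder
  isStrictTotalOrder : IsStrictTotalOrder _≈F_ _≺F_
  isStrictTotalOrder = record
    { isStrictPartialOrder = ≺F-isStrictPartialOrder
    ; compare = dec∧connected⇒trichotomous ≺F-isStrictPartialOrder
        (λ c c′ → ≡-dec FP._≟_ FP._≟_ (proj₁ c) (proj₁ c′))
        (λ {c} {c′} → ≺-connected (no-northeast-pair kernelPerm c c′)
                                  (no-northeast-pair kernelPerm c′ c))
    }
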